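{- Let $\mathcal H\subseteq 2^V$ be a Sperner hypergraph, $V=V_1\dot\cup V_2$ with $V_1,V_2\neq\emptyset$, and $S_0,S_1,S_2\subseteq V_1$ pairwise disjoint nonempty sets. Let $\mathcal H_1=\mathcal H_{V_1}\neq\emptyset$, $\mathcal H_2=\mathcal H_{V_2}$, $\mathcal F_1=\{H\in\mathcal H\mid H\cap V_1=S_0\cup S_2,\ H\cap V_2\ne\emptyset\}$, $\mathcal F_2=\{H\in\mathcal H\mid H\cap V_1=S_0\cup S_1,\ H\cap V_2\ne\emptyset\}$, with $\mathcal F_1,\mathcal F_2\neq\emptyset$ and $\mathcal H=\mathcal H_1\cup\mathcal H_2\cup\mathcal F_1\cup\mathcal F_2$. For $i=0,1,2$ let $\mathcal T_i=\{T\in\operatorname{Tr}(\mathcal H_1)\mid T\cap S_i\neq\emptyset,\ T\cap S_j=\emptyset\ (j\neq i)\}$, let $\mathcal T=\operatorname{Tr}(\mathcal H_1)\setminus(\mathcal T_0\cup\mathcal T_1\cup\mathcal T_2)$, and let $\mathcal P=\mathcal H_{S_0\cup S_1\cup S_2}$. Assume $\mathcal T=\emptyset$, and that $v^*\in S_0\cup S_2$ and $P\in\mathcal P$ satisfy $v^*\notin P$. Let $\mathcal F_1^*=\{F\cup\{v^*\}\mid F\in\mathcal F_1^{V_2}\}\cup\mathcal H_2$ and $\mathcal T^1=\{U\in\operatorname{Tr}(\mathcal F_1^*)\mid v^*\in U\}$. Then for every $T\in\mathcal T_1$ and every $U\in\mathcal T^1$, $T\cup U\in\operatorname{Tr}(\mathcal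 H)$.
   Context: $\operatorname{Tr}(\mathcal G)$ is the family of inclusion-minimal transversals of $\mathcal G$ (sets meeting every hyperedge). A hypergraph is Sperner if no hyperedge contains another. $\mathcal H_S=\{H\in\mathcal H\mid H\subseteq S\}$; $\mathcal G^S=\operatorname{Min}\{G\cap S\mid G\in\mathcal G\}$; $\operatorname{Min}$ takes inclusion-minimal members. -}

module Defs where

open import Data.Nat using (ℕ)
open import Data.Fin using (Fin)
open import Data.Fin.Subset
open import Data.Product using (Σ; ∃; _×_; _,_)
open import Data.Sum using (_⊎_)
open import Relation.Nullary using (¬_)
open import Relation.Binary.PropositionalEquality using (_≡_)

Hypergraph : ℕ → Set₁
Hypergraph n = Subset n → Set

module _ {n : ℕ} where

  Sperner : Hypergraph n → Set
  Sperner 𝓗 = ∀ A B → 𝓗 A → 𝓗 B → A ⊆ B → A ≡ B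

  IsTransversal : Hypergraph n → Subset n → Set
  IsTransversal 𝓖 T = ∀ G → 𝓖 G → Nonempty (T ∩ G)

  Tr : Hypergraph n → Hypergraph n
  Tr 𝓖 T = IsTransversal 𝓖 T × (∀ T' → T' ⊆ T → IsTransversal 𝓖 T' → T' ≡ T)

  Min : Hypergraph n → Hypergraph n
  Min 𝓐 A = 𝓐 A × (∀ B → 𝓐 B → B ⊆ A → B ≡ A)

  restrict : Hypergraph n → Subset n → Hypergraph n
  restrict 𝓗 S H = 𝓗 H × H ⊆ S

  project : Hypergraph n → Subset n → Hypergraph n
  project 𝓖 S = Min (λ A → ∃ λ G → 𝓖 G × A ≡ G ∩ S)

  _∪ₕ_ : Hypergraph n → Hypergraph n → Hypergraph n
  (𝓐 ∪ₕ 𝓑) A = 𝓐 A ⊎ 𝓑 A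

  EmptyH : Hypergraph n → Set
  EmptyH 𝓐 = ∀ A → ¬ 𝓐 A

-- T ∪ U meets every edge: T handles 𝓗₁, U handles 𝓗₂, v* ∈ U lies in every
-- edge of 𝓕₁, and T meets S₁, which lies in every edge of 𝓕₂.  For minimality
-- let T' ⊆ T ∪ U be a transversal of 𝓗.  Since U ⊆ V₂ ∪ {v*}, the part T' ∩ V₁
-- is a transversal of 𝓗₁ inside T ∪ {v*}.  A minimal transversal M of 𝓗₁ inside
-- it cannot contain v*: otherwise M ∈ 𝓣₀ ∪ 𝓣₂ misses S₁, yet M meets P ⊆ S₀ ∪ S₁ ∪ S₂
-- in a vertex of T (as v* ∉ P), which misses S₀ ∪ S₂.  Hence M ⊆ T, so M = T ⊆ T'.
-- Symmetrically T' ∩ (V₂ ∪ {v*}) ⊆ U is a transversal of 𝓕₁*: an edge of 𝓕₁ is met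
-- by T' either in v* or in V₂, since its trace on V₁ is S₀ ∪ S₂, which T misses.
-- So U ⊆ T' by minimality of U.
module Submission where

open import Defs
open import Data.Nat using (ℕ)
open import Data.Fin using (Fin)
open import Data.Fin.Subset
open import Data.Fin.Subset.Properties
open import Data.Fin.Subset.Induction using (Acc; acc; ⊂-wellFounded)
open import Data.Product using (∃; _×_; _,_; proj₁; proj₂)
open import Data.Sum using (_⊎_; inj₁; inj₂; [_,_]′)
open import Data.Empty using (⊥-elim)
open import Relation.Nullary using (¬_; yes; no)
open import Relation.Nullary.Decidable using (decidable-stable)
open import Relation.Binary.PropositionalEquality using (_≡_; refl; sym; subst)

module _ {n : ℕ} where

  ∩≡⊥⇒∉ : {A B : Subset n} {x : Fin n} → A ∩ B ≡ ⊥ → x ∈ A → x ∉ B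
  ∩≡⊥⇒∉ A∩B≡⊥ x∈A x∈B = ∉⊥ (subst (_ ∈_) A∩B≡⊥ (x∈p∩q⁺ (x∈A , x∈B)))

  ∉-∪ : {A B : Subset n} {x : Fin n} → x ∉ A → x ∉ B → x ∉ A ∪ B
  ∉-∪ x∉A x∉B x∈A∪B = [ x∉A , x∉B ]′ (x∈p∪q⁻ _ _ x∈A∪B)

  ∈-∩≡ : {H V S : Subset n} {x : Fin n} → H ∩ V ≡ S → x ∈ S → x ∈ H
  ∈-∩≡ {H} {V} refl x∈H∩V = p∩q⊆p H V x∈H∩V

  _⊆ₕ_ : Hypergraph n → Hypergraph n → Set
  𝓐 ⊆ₕ 𝓑 = ∀ A → 𝓐 A → 𝓑 A

  project-⊆ : {𝓖 : Hypergraph n} {S A : Subset n} → project 𝓖 S A → A ⊆ S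
  project-⊆ {S = S} ((G , _ , refl) , _) = p∩q⊆q G S

  module _ {𝓖 : Hypergraph n} where

    IsTransversal-mono : {T T' : Subset n} → T ⊆ T' → IsTransversal 𝓖 T → IsTransversal 𝓖 T'
    IsTransversal-mono {T} T⊆T' trT G 𝓖G =
      let x , x∈T∩G = trT G 𝓖G in x , x∈p∩q⁺ (T⊆T' (p∩q⊆p T G x∈T∩G) , p∩q⊆q T G x∈T∩G)

    IsTransversal-antimono : {𝓐 : Hypergraph n} {T : Subset n} →
      𝓐 ⊆ₕ 𝓖 → IsTransversal 𝓖 T → IsTransversal 𝓐 T
    IsTransversal-antimono 𝓐⊆𝓖 trT A 𝓐A = trT A (𝓐⊆𝓖 A 𝓐A)

    IsTransversal-∪ₕ : {𝓑 : Hypergraph n} {T : Subset n} →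
      IsTransversal 𝓖 T → IsTransversal 𝓑 T → IsTransversal (𝓖 ∪ₕ 𝓑) T
    IsTransversal-∪ₕ trT _ G (inj₁ 𝓖G) = trT G 𝓖G
    IsTransversal-∪ₕ _ trT B (inj₂ 𝓑B) = trT B 𝓑B

    IsTransversal-common : {T : Subset n} {x : Fin n} →
      x ∈ T → (∀ G → 𝓖 G → x ∈ G) → IsTransversal 𝓖 T
    IsTransversal-common {x = x} x∈T x∈edges G 𝓖G = x , x∈p∩q⁺ (x∈T , x∈edges G 𝓖G)

    IsTransversal-∩ : {T W : Subset n} →
      (∀ G → 𝓖 G → G ⊆ W) → IsTransversal 𝓖 T → IsTransversal 𝓖 (T ∩ W)
    IsTransversal-∩ {T} {W} edges⊆W trT G 𝓖G =
      let x , x∈T∩G = trT G 𝓖G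
          x∈G = p∩q⊆q T G x∈T∩G
      in x , x∈p∩q⁺ (x∈p∩q⁺ (p∩q⊆p T G x∈T∩G , edges⊆W G 𝓖G x∈G) , x∈G)

    Tr-⊇ : {U X : Subset n} → Tr 𝓖 U → X ⊆ U → IsTransversal 𝓖 X → U ⊆ X
    Tr-⊇ (_ , minimal) X⊆U trX = ⊆-reflexive (sym (minimal _ X⊆U trX))

    Tr-⊆-cover : {T W : Subset n} → (∀ G → 𝓖 G → G ⊆ W) → Tr 𝓖 T → T ⊆ W
    Tr-⊆-cover {T} {W} edges⊆W trT =
      ⊆-trans (Tr-⊇ trT (p∩q⊆p T W) (IsTransversal-∩ edges⊆W (proj₁ trT))) (p∩q⊆q T W)

    -- Classically every transversal contains a minimal one; the double negation
    -- suffices because membership in a subset is decidable.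
    Tr-below : {X : Subset n} → Acc _⊂_ X → IsTransversal 𝓖 X →
      ¬ ¬ (∃ λ M → M ⊆ X × Tr 𝓖 M)
    Tr-below {X} (acc smaller) trX noMinimal = noMinimal (X , ⊆-refl , trX , minimal)
      where
        minimal : ∀ Y → Y ⊆ X → IsTransversal 𝓖 Y → Y ≡ X
        minimal Y Y⊆X trY = ⊆-antisym Y⊆X λ {x} x∈X → decidable-stable (x ∈? Y) λ x∉Y →
          Tr-below (smaller (Y⊆X , x , x∈X , x∉Y)) trY
            λ (M , M⊆Y , trM) → noMinimal (M , ⊆-trans M⊆Y Y⊆X , trM)

    Tr-⊆-transversal : {T Y : Subset n} → Tr 𝓖 T →
      (∀ M → M ⊆ Y → Tr 𝓖 M → M ⊆ T) → IsTransversal 𝓖 Y → T ⊆ Y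
    Tr-⊆-transversal {T} {Y} trT below⊆T trY {x} x∈T =
      decidable-stable (x ∈? Y) λ x∉Y → Tr-below (⊂-wellFounded Y) trY
        λ (M , M⊆Y , trM) → x∉Y (M⊆Y (Tr-⊇ trT (below⊆T M M⊆Y trM) (proj₁ trM) x∈T))

module Decomposition {n : ℕ} (𝓗 : Hypergraph n) (V₁ V₂ S₀ S₁ S₂ : Subset n) (v* : Fin n) where

  𝓗₁ 𝓗₂ 𝓕₁ 𝓕₂ 𝓕₁* : Hypergraph n
  𝓗₁ = restrict 𝓗 V₁
  𝓗₂ = restrict 𝓗 V₂
  𝓕₁ H = 𝓗 H × H ∩ V₁ ≡ S₀ ∪ S₂ × Nonempty (H ∩ V₂)
  𝓕₂ H = 𝓗 H × H ∩ V₁ ≡ S₀ ∪ S₁ × Nonempty (H ∩ V₂)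
  𝓕₁* = (λ A → ∃ λ F → project 𝓕₁ V₂ F × A ≡ F ∪ ⁅ v* ⁆) ∪ₕ 𝓗₂

  𝓣₀ 𝓣₁ 𝓣₂ : Hypergraph n
  𝓣₀ T = Tr 𝓗₁ T × Nonempty (T ∩ S₀) × T ∩ S₁ ≡ ⊥ × T ∩ S₂ ≡ ⊥
  𝓣₁ T = Tr 𝓗₁ T × Nonempty (T ∩ S₁) × T ∩ S₀ ≡ ⊥ × T ∩ S₂ ≡ ⊥
  𝓣₂ T = Tr 𝓗₁ T × Nonempty (T ∩ S₂) × T ∩ S₀ ≡ ⊥ × T ∩ S₁ ≡ ⊥

  W : Subset n
  W = V₂ ∪ ⁅ v* ⁆

  𝓕₁*⊆W : ∀ A → 𝓕₁* A → A ⊆ W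
  𝓕₁*⊆W _ (inj₁ (F , F∈𝓕₁^V₂ , refl)) x∈F∪v* =
    [ (λ x∈F → p⊆p∪q _ (project-⊆ F∈𝓕₁^V₂ x∈F)) , q⊆p∪q V₂ _ ]′ (x∈p∪q⁻ F _ x∈F∪v*)
  𝓕₁*⊆W _ (inj₂ (_ , A⊆V₂)) x∈A = p⊆p∪q _ (A⊆V₂ x∈A)

  module _ (V₁∩V₂≡⊥ : V₁ ∩ V₂ ≡ ⊥) (V₁∪V₂≡⊤ : V₁ ∪ V₂ ≡ ⊤)
           (cover : 𝓗 ⊆ₕ (𝓗₁ ∪ₕ (𝓗₂ ∪ₕ (𝓕₁ ∪ₕ 𝓕₂))))
           (no-𝓣 : ∀ M → Tr 𝓗₁ M → 𝓣₀ M ⊎ 𝓣₁ M ⊎ 𝓣₂ M)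
           (v*∈S₀∪S₂ : v* ∈ S₀ ∪ S₂)
           (P : Subset n) (P∈𝓗₁ : 𝓗₁ P) (P⊆S : P ⊆ S₀ ∪ S₁ ∪ S₂) (v*∉P : v* ∉ P)
           (T : Subset n) (T∈𝓣₁ : 𝓣₁ T) (U : Subset n) (trU : Tr 𝓕₁* U) (v*∈U : v* ∈ U)
           where

    trT : Tr 𝓗₁ T
    trT = proj₁ T∈𝓣₁

    T∉S₀∪S₂ : ∀ {x} → x ∈ T → x ∉ S₀ ∪ S₂
    T∉S₀∪S₂ x∈T = let _ , _ , T∩S₀≡⊥ , T∩S₂≡⊥ = T∈𝓣₁ in
      ∉-∪ (∩≡⊥⇒∉ T∩S₀≡⊥ x∈T) (∩≡⊥⇒∉ T∩S₂≡⊥ x∈T)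

    T⊆V₁ : T ⊆ V₁
    T⊆V₁ = Tr-⊆-cover (λ _ → proj₂) trT

    U⊆W : U ⊆ W
    U⊆W = Tr-⊆-cover 𝓕₁*⊆W trU

    T∪U-transversal : IsTransversal 𝓗 (T ∪ U)
    T∪U-transversal = IsTransversal-antimono cover
      (IsTransversal-∪ₕ (IsTransversal-mono (p⊆p∪q U) (proj₁ trT))
      (IsTransversal-∪ₕ (IsTransversal-mono (q⊆p∪q T U) trU-𝓗₂)
      (IsTransversal-∪ₕ (IsTransversal-common (q⊆p∪q T U v*∈U) v*∈𝓕₁)
                        (IsTransversal-common (p⊆p∪q U t∈T) t∈𝓕₂))))
      where
        trU-𝓗₂ : IsTransversal 𝓗₂ U
        trU-𝓗₂ = IsTransversal-antimono (λ _ → inj₂) (proj₁ trU)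

        v*∈𝓕₁ : ∀ G → 𝓕₁ G → v* ∈ G
        v*∈𝓕₁ _ (_ , G∩V₁≡ , _) = ∈-∩≡ G∩V₁≡ v*∈S₀∪S₂

        t : Fin n
        t = proj₁ (proj₁ (proj₂ T∈𝓣₁))

        t∈T∩S₁ : t ∈ T ∩ S₁
        t∈T∩S₁ = proj₂ (proj₁ (proj₂ T∈𝓣₁))

        t∈T : t ∈ T
        t∈T = p∩q⊆p T S₁ t∈T∩S₁

        t∈𝓕₂ : ∀ G → 𝓕₂ G → t ∈ G
        t∈𝓕₂ _ (_ , G∩V₁≡ , _) = ∈-∩≡ G∩V₁≡ (q⊆p∪q S₀ S₁ (p∩q⊆q T S₁ t∈T∩S₁))

    Tr𝓗₁∋v*⇒∩S₁≡⊥ : ∀ M → Tr 𝓗₁ M → v* ∈ M → M ∩ S₁ ≡ ⊥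
    Tr𝓗₁∋v*⇒∩S₁≡⊥ M trM v*∈M with no-𝓣 M trM
    ... | inj₁ (_ , _ , M∩S₁≡⊥ , _) = M∩S₁≡⊥
    ... | inj₂ (inj₁ (_ , _ , M∩S₀≡⊥ , M∩S₂≡⊥)) =
      ⊥-elim (∉-∪ (∩≡⊥⇒∉ M∩S₀≡⊥ v*∈M) (∩≡⊥⇒∉ M∩S₂≡⊥ v*∈M) v*∈S₀∪S₂)
    ... | inj₂ (inj₂ (_ , _ , _ , M∩S₁≡⊥)) = M∩S₁≡⊥

    P∩T⊆S₁ : ∀ {x} → x ∈ P → x ∈ T → x ∈ S₁
    P∩T⊆S₁ x∈P x∈T with x∈p∪q⁻ S₀ _ (P⊆S x∈P)
    ... | inj₁ x∈S₀ = ⊥-elim (T∉S₀∪S₂ x∈T (p⊆p∪q S₂ x∈S₀))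
    ... | inj₂ x∈S₁∪S₂ with x∈p∪q⁻ S₁ S₂ x∈S₁∪S₂
    ...   | inj₁ x∈S₁ = x∈S₁
    ...   | inj₂ x∈S₂ = ⊥-elim (T∉S₀∪S₂ x∈T (q⊆p∪q S₀ S₂ x∈S₂))

    Tr𝓗₁-below-T∪v*-avoids-v* : ∀ M → M ⊆ T ∪ ⁅ v* ⁆ → Tr 𝓗₁ M → v* ∉ M
    Tr𝓗₁-below-T∪v*-avoids-v* M M⊆T∪v* trM v*∈M with proj₁ trM P P∈𝓗₁
    ... | x , x∈M∩P with x∈p∩q⁻ M P x∈M∩P
    ...   | x∈M , x∈P with x∈p∪q⁻ T _ (M⊆T∪v* x∈M)
    ...     | inj₂ x∈⁅v*⁆ = v*∉P (subst (_∈ P) (x∈⁅y⁆⇒x≡y v* x∈⁅v*⁆) x∈P)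
    ...     | inj₁ x∈T = ∩≡⊥⇒∉ (Tr𝓗₁∋v*⇒∩S₁≡⊥ M trM v*∈M) x∈M (P∩T⊆S₁ x∈P x∈T)

    module _ (T' : Subset n) (T'⊆T∪U : T' ⊆ T ∪ U) (trT' : IsTransversal 𝓗 T') where

      T'∩V₁⊆T∪v* : T' ∩ V₁ ⊆ T ∪ ⁅ v* ⁆
      T'∩V₁⊆T∪v* x∈T'∩V₁ with x∈p∩q⁻ T' V₁ x∈T'∩V₁
      ... | x∈T' , x∈V₁ with x∈p∪q⁻ T U (T'⊆T∪U x∈T')
      ...   | inj₁ x∈T = p⊆p∪q _ x∈T
      ...   | inj₂ x∈U with x∈p∪q⁻ V₂ _ (U⊆W x∈U)
      ...     | inj₁ x∈V₂ = ⊥-elim (∩≡⊥⇒∉ V₁∩V₂≡⊥ x∈V₁ x∈V₂)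
      ...     | inj₂ x∈⁅v*⁆ = q⊆p∪q T _ x∈⁅v*⁆

      T'∩W⊆U : T' ∩ W ⊆ U
      T'∩W⊆U x∈T'∩W with x∈p∩q⁻ T' W x∈T'∩W
      ... | x∈T' , x∈W with x∈p∪q⁻ T U (T'⊆T∪U x∈T')
      ...   | inj₂ x∈U = x∈U
      ...   | inj₁ x∈T with x∈p∪q⁻ V₂ _ x∈W
      ...     | inj₁ x∈V₂ = ⊥-elim (∩≡⊥⇒∉ V₁∩V₂≡⊥ (T⊆V₁ x∈T) x∈V₂)
      ...     | inj₂ x∈⁅v*⁆ =
        ⊥-elim (T∉S₀∪S₂ x∈T (subst (_∈ S₀ ∪ S₂) (sym (x∈⁅y⁆⇒x≡y v* x∈⁅v*⁆)) v*∈S₀∪S₂))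

      T⊆T' : T ⊆ T'
      T⊆T' x∈T = p∩q⊆p T' V₁ (Tr-⊆-transversal trT below⊆T trT'∩V₁ x∈T)
        where
          trT'∩V₁ : IsTransversal 𝓗₁ (T' ∩ V₁)
          trT'∩V₁ = IsTransversal-∩ (λ _ → proj₂) (IsTransversal-antimono (λ _ → proj₁) trT')

          below⊆T : ∀ M → M ⊆ T' ∩ V₁ → Tr 𝓗₁ M → M ⊆ T
          below⊆T M M⊆T'∩V₁ trM x∈M with x∈p∪q⁻ T _ (T'∩V₁⊆T∪v* (M⊆T'∩V₁ x∈M))
          ... | inj₁ x∈T = x∈T
          ... | inj₂ x∈⁅v*⁆ = ⊥-elim (Tr𝓗₁-below-T∪v*-avoids-v* M (⊆-trans M⊆T'∩V₁ T'∩V₁⊆T∪v*) trM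
                                (subst (_∈ M) (x∈⁅y⁆⇒x≡y v* x∈⁅v*⁆) x∈M))

      T'∩𝓕₁⊆V₂ : ∀ {G} → 𝓕₁ G → v* ∉ T' → T' ∩ G ⊆ V₂
      T'∩𝓕₁⊆V₂ {G} (_ , G∩V₁≡ , _) v*∉T' {x} x∈T'∩G with x∈p∪q⁻ V₁ V₂ (subst (x ∈_) (sym V₁∪V₂≡⊤) ∈⊤)
      ... | inj₂ x∈V₂ = x∈V₂
      ... | inj₁ x∈V₁ with x∈p∩q⁻ T' G x∈T'∩G
      ...   | x∈T' , x∈G with x∈p∪q⁻ T _ (T'∩V₁⊆T∪v* (x∈p∩q⁺ (x∈T' , x∈V₁)))
      ...     | inj₁ x∈T = ⊥-elim (T∉S₀∪S₂ x∈T (subst (x ∈_) G∩V₁≡ (x∈p∩q⁺ (x∈G , x∈V₁))))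
      ...     | inj₂ x∈⁅v*⁆ = ⊥-elim (v*∉T' (subst (_∈ T') (x∈⁅y⁆⇒x≡y v* x∈⁅v*⁆) x∈T'))

      trT'∩W : IsTransversal 𝓕₁* (T' ∩ W)
      trT'∩W = IsTransversal-∪ₕ meets-projection
        (IsTransversal-∩ (λ _ (_ , A⊆V₂) x∈A → p⊆p∪q _ (A⊆V₂ x∈A))
                         (IsTransversal-antimono (λ _ → proj₁) trT'))
        where
          meets-projection : ∀ A → (∃ λ F → project 𝓕₁ V₂ F × A ≡ F ∪ ⁅ v* ⁆) → Nonempty ((T' ∩ W) ∩ A)
          meets-projection _ (_ , ((G , G∈𝓕₁ , refl) , _) , refl) with v* ∈? T'
          ... | yes v*∈T' = v* , x∈p∩q⁺ (x∈p∩q⁺ (v*∈T' , v*∈) , v*∈)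
            where
              v*∈ : ∀ {B} → v* ∈ B ∪ ⁅ v* ⁆
              v*∈ {B} = q⊆p∪q B ⁅ v* ⁆ (x∈⁅x⁆ v*)
          ... | no v*∉T' =
            let x , x∈T'∩G = trT' G (proj₁ G∈𝓕₁)
                x∈V₂ = T'∩𝓕₁⊆V₂ G∈𝓕₁ v*∉T' x∈T'∩G
            in x , x∈p∩q⁺ ( x∈p∩q⁺ (p∩q⊆p T' G x∈T'∩G , p⊆p∪q _ x∈V₂)
                          , p⊆p∪q _ (x∈p∩q⁺ (p∩q⊆q T' G x∈T'∩G , x∈V₂)))

      U⊆T' : U ⊆ T'
      U⊆T' x∈U = p∩q⊆p T' W (Tr-⊇ trU T'∩W⊆U trT'∩W x∈U)

    Tr-T∪U : Tr 𝓗 (T ∪ U)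
    Tr-T∪U = T∪U-transversal , λ T' T'⊆T∪U trT' →
      ⊆-antisym T'⊆T∪U λ x∈T∪U →
        [ T⊆T' T' T'⊆T∪U trT' , U⊆T' T' T'⊆T∪U trT' ]′ (x∈p∪q⁻ T U x∈T∪U)

lemma11 : {n : ℕ} (𝓗 : Hypergraph n) (V₁ V₂ S₀ S₁ S₂ : Subset n) →
    Sperner 𝓗 →
    V₁ ∩ V₂ ≡ ⊥ → V₁ ∪ V₂ ≡ ⊤ → Nonempty V₁ → Nonempty V₂ →
    S₀ ⊆ V₁ → S₁ ⊆ V₁ → S₂ ⊆ V₁ →
    S₀ ∩ S₁ ≡ ⊥ → S₀ ∩ S₂ ≡ ⊥ → S₁ ∩ S₂ ≡ ⊥ →
    Nonempty S₀ → Nonempty S₁ → Nonempty S₂ →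
    let 𝓗₁ = restrict 𝓗 V₁
        𝓗₂ = restrict 𝓗 V₂
        𝓕₁ = λ H → 𝓗 H × H ∩ V₁ ≡ S₀ ∪ S₂ × Nonempty (H ∩ V₂)
        𝓕₂ = λ H → 𝓗 H × H ∩ V₁ ≡ S₀ ∪ S₁ × Nonempty (H ∩ V₂)
        𝓣₀ = λ T → Tr 𝓗₁ T × Nonempty (T ∩ S₀) × T ∩ S₁ ≡ ⊥ × T ∩ S₂ ≡ ⊥
        𝓣₁ = λ T → Tr 𝓗₁ T × Nonempty (T ∩ S₁) × T ∩ S₀ ≡ ⊥ × T ∩ S₂ ≡ ⊥
        𝓣₂ = λ T → Tr 𝓗₁ T × Nonempty (T ∩ S₂) × T ∩ S₀ ≡ ⊥ × T ∩ S₁ ≡ ⊥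
        𝓟 = restrict 𝓗 (S₀ ∪ S₁ ∪ S₂)
    in (∃ λ H → 𝓗₁ H) → (∃ λ F → 𝓕₁ F) → (∃ λ F → 𝓕₂ F) →
       (∀ H → 𝓗 H → 𝓗₁ H ⊎ 𝓗₂ H ⊎ 𝓕₁ H ⊎ 𝓕₂ H) →
       (∀ T → Tr 𝓗₁ T → 𝓣₀ T ⊎ 𝓣₁ T ⊎ 𝓣₂ T) →
       (v* : Fin n) → v* ∈ S₀ ∪ S₂ →
       (P : Subset n) → 𝓟 P → v* ∉ P →
       let 𝓕₁* = (λ A → ∃ λ F → project 𝓕₁ V₂ F × A ≡ F ∪ ⁅ v* ⁆) ∪ₕ 𝓗₂
           𝓣¹ = λ U → Tr 𝓕₁* U × v* ∈ U
       in ∀ T U → 𝓣₁ T → 𝓣¹ U → Tr 𝓗 (T ∪ U)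
lemma11 𝓗 V₁ V₂ S₀ S₁ S₂ _ V₁∩V₂≡⊥ V₁∪V₂≡⊤ _ _ S₀⊆V₁ S₁⊆V₁ S₂⊆V₁ _ _ _ _ _ _ _ _ _
        cover no-𝓣 v* v*∈S₀∪S₂ P (𝓗P , P⊆S) v*∉P T U T∈𝓣₁ (trU , v*∈U) =
  Tr-T∪U V₁∩V₂≡⊥ V₁∪V₂≡⊤ cover no-𝓣 v*∈S₀∪S₂ P (𝓗P , P⊆V₁) P⊆S v*∉P T T∈𝓣₁ U trU v*∈U
  where
    open Decomposition 𝓗 V₁ V₂ S₀ S₁ S₂ v*

    P⊆V₁ : P ⊆ V₁
    P⊆V₁ x∈P = [ S₀⊆V₁ , (λ x∈S₁∪S₂ → [ S₁⊆V₁ , S₂⊆V₁ ]′ (x∈p∪q⁻ S₁ S₂ x∈S₁∪S₂)) ]′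
                 (x∈p∪q⁻ S₀ _ (P⊆S x∈P))
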